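{- Let $d\ge 3$, let $S=[l_1,\dots,l_m]$ be a multiset of non-negative integers, and let $\bar x,\bar y,\bar z$ be a triangle (three pairwise adjacent vertices) in the polygraph $(\mathbb{T}_d)_S$. Then the center $\bar c$ of $\bar x,\bar y,\bar z$ is a midpoint of each of the pairs $(\bar x,\bar y)$, $(\bar y,\bar z)$, $(\bar x,\bar z)$.
   Context: $\mathbb{T}_d$ is the infinite $d$-regular tree with graph metric $\rho$. $(\mathbb{T}_d)_S$ has vertex set $V(\mathbb{T}_d)^m$, with $(x_1,\dots,x_m)\sim(y_1,\dots,y_m)$ iff $[\rho(x_1,y_1),\dots,\rho(x_m,y_m)]=S$ as multisets. For vertices $x,y,z$ of a tree, their center is the unique vertex $c$ minimizing $\rho(x,c)+\rho(y,c)+\rho(z,c)$. The center of $\bar x,\bar y,\bar z$ is $\bar c=(c_1,\dots,c_m)$ with $c_i$ the center of $x_i,y_i,z_i$. Let $\delta(\bar u,\bar v)=\sum_{i}\rho(u_i,v_i)$; $\bar w$ is a midpoint of $\bar u,\bar v$ if $\delta(\bar u,\bar w)=\delta(\bar v,\bar w)=\delta(\bar u,\bar v)/2$. -}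

module Defs where

open import Data.Nat using (ℕ; zero; suc; _+_; _≤_)
open import Data.Fin using (Fin)
open import Data.List using (List; []; _∷_)
open import Data.Vec using (Vec; lookup; toList)
open import Data.Unit using (⊤)
open import Data.Product using (Σ; ∃; ∃-syntax; _×_; _,_)
open import Data.Sum using (_⊎_)
open import Relation.Binary.PropositionalEquality using (_≡_; _≢_)
open import Data.List.Relation.Binary.Permutation.Propositional using (_↭_)

-- The infinite d-regular tree 𝕋_d, modelled as the Cayley graph of the
-- free product of d copies of ℤ/2: vertices are reduced words over the
-- alphabet Fin d (no two consecutive letters equal); the word a ∷ w is
-- adjacent to w.  The empty word has d neighbours, every other word has
-- (d-1) + 1 = d neighbours, and the graph is a tree.

Reduced : {d : ℕ} → List (Fin d) → Set
Reduced [] = ⊤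
Reduced (a ∷ []) = ⊤
Reduced (a ∷ b ∷ w) = a ≢ b × Reduced (b ∷ w)

record Vertex (d : ℕ) : Set where
  constructor vtx
  field
    word    : List (Fin d)
    reduced : Reduced word
open Vertex public

Adj : {d : ℕ} → Vertex d → Vertex d → Set
Adj {d} u v = (∃[ a ] word v ≡ a ∷ word u) ⊎ (∃[ a ] word u ≡ a ∷ word v)

data Walk {d : ℕ} : Vertex d → Vertex d → ℕ → Set where
  here : ∀ {x} → Walk x x zero
  step : ∀ {x y z n} → Adj x y → Walk y z n → Walk x z (suc n)

Dist : {d : ℕ} → Vertex d → Vertex d → ℕ → Set
Dist x y n = Walk x y n × (∀ k → Walk x y k → n ≤ k)

IsCenter : {d : ℕ} → Vertex d → Vertex d → Vertex d → Vertex d → Set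
IsCenter {d} x y z c =
  Σ ℕ λ a → Σ ℕ λ b → Σ ℕ λ e →
    Dist x c a × Dist y c b × Dist z c e ×
    (∀ (c' : Vertex d) a' b' e' →
       Dist x c' a' → Dist y c' b' → Dist z c' e' → a + b + e ≤ a' + b' + e')

Tuple : ℕ → ℕ → Set
Tuple d m = Vec (Vertex d) m

DistVec : {d m : ℕ} → Tuple d m → Tuple d m → Vec ℕ m → Set
DistVec xs ys ds = ∀ i → Dist (lookup xs i) (lookup ys i) (lookup ds i)

sumV : {m : ℕ} → Vec ℕ m → ℕ
sumV Data.Vec.[] = 0
sumV (n Data.Vec.∷ ns) = n + sumV ns

δ≡ : {d m : ℕ} → Tuple d m → Tuple d m → ℕ → Set
δ≡ {m = m} xs ys n = Σ (Vec ℕ m) λ ds → DistVec xs ys ds × sumV ds ≡ n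

-- adjacency in the polygraph (𝕋_d)_S, S given as the list l_1,…,l_m;
-- multiset equality = permutation of lists
PolyAdj : {d m : ℕ} → Vec ℕ m → Tuple d m → Tuple d m → Set
PolyAdj {m = m} S xs ys =
  Σ (Vec ℕ m) λ ds → DistVec xs ys ds × (toList ds ↭ toList S)

Midpoint : {d m : ℕ} → Tuple d m → Tuple d m → Tuple d m → Set
Midpoint us vs ws =
  Σ ℕ λ a → Σ ℕ λ b → Σ ℕ λ D →
    δ≡ us ws a × δ≡ vs ws b × δ≡ us vs D × a ≡ b × a + a ≡ D

module Submission where

-- In a tree the median m of x, y, z lies on all three geodesics, so
-- 2(ρ(x,m) + ρ(y,m) + ρ(z,m)) = ρ(x,y) + ρ(y,z) + ρ(x,z).  A center c does at
-- least as well as m, while the triangle inequality bounds each ρ(x,y) by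
-- ρ(x,c) + ρ(c,y); squeezing forces equality, so c lies on the three geodesics.
-- Summing over coordinates, δ(x̄,ȳ) = α + β, δ(ȳ,z̄) = β + γ, δ(x̄,z̄) = α + γ with
-- α = δ(x̄,c̄), β = δ(ȳ,c̄), γ = δ(z̄,c̄).  Each side of a triangle of (𝕋_d)_S has
-- the same multiset S of coordinate distances, hence the same δ = ΣS, which
-- forces α = β = γ.

open import Defs

open import Data.Empty using (⊥-elim)
open import Data.Fin using (Fin)
import Data.Fin as Fin
open import Data.List using (List; []; _∷_; _++_; _∷ʳ_; length; reverse)
open import Data.List.Properties
  using (≡-dec; length-++; length-reverse; reverse-++; reverse-injective; reverse-involutive; unfold-reverse)
open import Data.List.Relation.Binary.Permutation.Propositional using (_↭_)
open import Data.Nat using (ℕ; zero; suc; _+_; _*_; _≤_; _<_; z≤n; s≤s)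
open import Data.Nat.ListAction using (sum)
open import Data.Nat.ListAction.Properties using (sum-↭)
open import Data.Nat.Properties
open import Data.Nat.Tactic.RingSolver using (solve-∀)
open import Data.Product using (Σ; ∃-syntax; _×_; _,_; proj₁; proj₂)
open import Data.Sum using (_⊎_; inj₁; inj₂; [_,_]′)
import Data.Sum as Sum
open import Data.Unit using (tt)
open import Data.Vec using (Vec; []; _∷_; lookup; tabulate; toList)
open import Data.Vec.Properties using (lookup∘tabulate)
open import Function using (_∘_)
open import Relation.Binary.Definitions using (DecidableEquality)
open import Relation.Binary.PropositionalEquality
open import Relation.Nullary using (Dec; yes; no)

+-squeeze : ∀ {x y z a b c} → x ≤ a → y ≤ b → z ≤ c → a + b + c ≤ x + y + z → x ≡ a × y ≡ b × z ≡ c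
+-squeeze x≤a y≤b z≤c sum≤ =
  ≤-antisym x≤a (≮⇒≥ λ x<a → <⇒≱ (+-mono-<-≤ (+-mono-<-≤ x<a y≤b) z≤c) sum≤) ,
  ≤-antisym y≤b (≮⇒≥ λ y<b → <⇒≱ (+-mono-<-≤ (+-mono-≤-< x≤a y<b) z≤c) sum≤) ,
  ≤-antisym z≤c (≮⇒≥ λ z<c → <⇒≱ (+-mono-≤-< (+-mono-≤ x≤a y≤b) z<c) sum≤)

-- Lists ordered by prefix form a rooted tree: dist is its graph distance and
-- median the median of three of its vertices.
module PrefixTree {ℓ} {A : Set ℓ} (_≟_ : DecidableEquality A) where

  dist : List A → List A → ℕ
  dist []      v       = length v
  dist (a ∷ u) []      = suc (length u)
  dist (a ∷ u) (b ∷ v) with a ≟ b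
  ... | yes _ = dist u v
  ... | no  _ = suc (length u) + suc (length v)

  dist-∷ : ∀ a u v → dist (a ∷ u) (a ∷ v) ≡ dist u v
  dist-∷ a u v with a ≟ a
  ... | yes _  = refl
  ... | no a≢a = ⊥-elim (a≢a refl)

  dist-∷-≢ : ∀ {a b} u v → a ≢ b → dist (a ∷ u) (b ∷ v) ≡ suc (length u) + suc (length v)
  dist-∷-≢ {a} {b} u v a≢b with a ≟ b
  ... | yes a≡b = ⊥-elim (a≢b a≡b)
  ... | no  _   = refl

  dist-[]ʳ : ∀ u → dist u [] ≡ length u
  dist-[]ʳ []      = refl
  dist-[]ʳ (a ∷ u) = refl

  dist-refl : ∀ u → dist u u ≡ 0
  dist-refl []      = refl
  dist-refl (a ∷ u) = trans (dist-∷ a u u) (dist-refl u)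

  dist-sym : ∀ u v → dist u v ≡ dist v u
  dist-sym []      v       = sym (dist-[]ʳ v)
  dist-sym (a ∷ u) []      = refl
  dist-sym (a ∷ u) (b ∷ v) with a ≟ b
  ... | yes refl = trans (dist-sym u v) (sym (dist-∷ a v u))
  ... | no  a≢b  = trans (+-comm (suc (length u)) (suc (length v)))
                         (sym (dist-∷-≢ v u (≢-sym a≢b)))

  dist≡0⇒≡ : ∀ u v → dist u v ≡ 0 → u ≡ v
  dist≡0⇒≡ []      []      _ = refl
  dist≡0⇒≡ (a ∷ u) (b ∷ v) e with a ≟ b
  dist≡0⇒≡ (a ∷ u) (b ∷ v) e  | yes refl = cong (a ∷_) (dist≡0⇒≡ u v e)
  dist≡0⇒≡ (a ∷ u) (b ∷ v) () | no _

  dist-++ : ∀ p s → dist p (p ++ s) ≡ length s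
  dist-++ []      s = refl
  dist-++ (a ∷ p) s = trans (dist-∷ a p (p ++ s)) (dist-++ p s)

  length-∷ʳ : ∀ u (a : A) → length (u ∷ʳ a) ≡ suc (length u)
  length-∷ʳ u a = trans (length-++ u) (+-comm (length u) 1)

  dist-∷ʳ-≤ : ∀ w u a → dist w (u ∷ʳ a) ≤ suc (dist w u)
  dist-∷ʳ-≤ []      u       a = ≤-reflexive (length-∷ʳ u a)
  dist-∷ʳ-≤ (b ∷ w) []      a with b ≟ a
  ... | yes _ = ≤-trans (≤-reflexive (dist-[]ʳ w)) (m≤n+m _ 2)
  ... | no  _ = ≤-reflexive (cong suc (+-comm (length w) 1))
  dist-∷ʳ-≤ (b ∷ w) (c ∷ u) a with b ≟ c
  ... | yes _ = dist-∷ʳ-≤ w u a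
  ... | no  _ rewrite length-∷ʳ u a = ≤-reflexive (cong suc (+-suc (length w) (suc (length u))))

  dist-≤-∷ʳ : ∀ w u a → dist w u ≤ suc (dist w (u ∷ʳ a))
  dist-≤-∷ʳ []      u       a rewrite length-∷ʳ u a = m≤n+m _ 2
  dist-≤-∷ʳ (b ∷ w) []      a with b ≟ a
  ... | yes _ = ≤-reflexive (cong suc (sym (dist-[]ʳ w)))
  ... | no  _ rewrite +-comm (length w) 1 = m≤n+m _ 2
  dist-≤-∷ʳ (b ∷ w) (c ∷ u) a with b ≟ c
  ... | yes _ = dist-≤-∷ʳ w u a
  ... | no  _ rewrite length-∷ʳ u a =
        s≤s (≤-trans (+-monoʳ-≤ (length w) (n≤1+n _)) (n≤1+n _))

  Prefix : List A → List A → Set ℓ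
  Prefix p v = ∃[ s ] v ≡ p ++ s

  Prefix-∷ : ∀ a {p v} → Prefix p v → Prefix (a ∷ p) (a ∷ v)
  Prefix-∷ a (s , v≡) = s , cong (a ∷_) v≡

  Between : List A → List A → List A → Set
  Between m u v = dist m u + dist m v ≡ dist u v

  Between-sym : ∀ {m u v} → Between m u v → Between m v u
  Between-sym {m} {u} {v} b = trans (+-comm (dist m v) (dist m u)) (trans b (dist-sym u v))

  Between-∷ : ∀ a {m u v} → Between m u v → Between (a ∷ m) (a ∷ u) (a ∷ v)
  Between-∷ a {m} {u} {v} b rewrite dist-∷ a m u | dist-∷ a m v | dist-∷ a u v = b

  Between-[]ˡ : ∀ {p v} → Prefix p v → Between p [] v
  Between-[]ˡ {p} (s , refl) rewrite dist-[]ʳ p | dist-++ p s = sym (length-++ p)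

  Between-[]ʳ : ∀ {p v} → Prefix p v → Between p v []
  Between-[]ʳ {p} {v} v≡p++s = Between-sym {p} {[]} {v} (Between-[]ˡ v≡p++s)

  Between-branch : ∀ {a c p v} w → a ≢ c → Prefix p v → Between (a ∷ p) (a ∷ v) (c ∷ w)
  Between-branch {a} {c} {p} w a≢c (s , refl)
    rewrite dist-∷ a p (p ++ s) | dist-++ p s | dist-∷-≢ p w a≢c
          | dist-∷-≢ (p ++ s) w a≢c | length-++ p {s} = regroup (length s) (length p) (length w)
    where regroup : ∀ s p w → s + (suc p + suc w) ≡ suc (p + s) + suc w
          regroup = solve-∀

  Between-branchˡ : ∀ {a c p v} w → a ≢ c → Prefix p v → Between (a ∷ p) (c ∷ w) (a ∷ v)
  Between-branchˡ {a} {c} {p} {v} w a≢c v≡p++s =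
    Between-sym {a ∷ p} {a ∷ v} {c ∷ w} (Between-branch w a≢c v≡p++s)

  commonPrefix : List A → List A → List A
  commonPrefix []      v       = []
  commonPrefix (a ∷ u) []      = []
  commonPrefix (a ∷ u) (b ∷ v) with a ≟ b
  ... | yes _ = a ∷ commonPrefix u v
  ... | no  _ = []

  commonPrefix-prefixˡ : ∀ u v → Prefix (commonPrefix u v) u
  commonPrefix-prefixˡ []      v       = [] , refl
  commonPrefix-prefixˡ (a ∷ u) []      = a ∷ u , refl
  commonPrefix-prefixˡ (a ∷ u) (b ∷ v) with a ≟ b
  ... | yes _ = Prefix-∷ a (commonPrefix-prefixˡ u v)
  ... | no  _ = a ∷ u , refl

  commonPrefix-prefixʳ : ∀ u v → Prefix (commonPrefix u v) v
  commonPrefix-prefixʳ []      v       = v , refl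
  commonPrefix-prefixʳ (a ∷ u) []      = [] , refl
  commonPrefix-prefixʳ (a ∷ u) (b ∷ v) with a ≟ b
  ... | yes refl = Prefix-∷ a (commonPrefix-prefixʳ u v)
  ... | no  _    = b ∷ v , refl

  commonPrefix-between : ∀ u v → Between (commonPrefix u v) u v
  commonPrefix-between []      v       = refl
  commonPrefix-between (a ∷ u) []      = +-identityʳ _
  commonPrefix-between (a ∷ u) (b ∷ v) with a ≟ b
  ... | yes refl = trans (Between-∷ a (commonPrefix-between u v)) (dist-∷ a u v)
  ... | no  _    = refl

  dist-split : ∀ {p s t u v} → u ≡ p ++ s → v ≡ p ++ t → Between p u v → dist u v ≡ length s + length t
  dist-split {p} {s} {t} refl refl between = trans (sym between) (cong₂ _+_ (dist-++ p s) (dist-++ p t))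

  median : List A → List A → List A → List A
  median []      y       z       = commonPrefix y z
  median (a ∷ x) []      z       = commonPrefix (a ∷ x) z
  median (a ∷ x) (b ∷ y) []      = commonPrefix (a ∷ x) (b ∷ y)
  median (a ∷ x) (b ∷ y) (c ∷ z) with a ≟ b | a ≟ c | b ≟ c
  ... | yes _ | yes _ | _     = a ∷ median x y z
  ... | yes _ | no  _ | _     = a ∷ commonPrefix x y
  ... | no  _ | yes _ | _     = a ∷ commonPrefix x z
  ... | no  _ | no  _ | yes _ = b ∷ commonPrefix y z
  ... | no  _ | no  _ | no  _ = []

  IsMedian : List A → List A → List A → List A → Set
  IsMedian m x y z = Between m x y × Between m y z × Between m x z

  median-isMedian : ∀ x y z → IsMedian (median x y z) x y z
  median-isMedian [] y z =
    Between-[]ˡ (commonPrefix-prefixˡ y z) , commonPrefix-between y z ,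
    Between-[]ˡ (commonPrefix-prefixʳ y z)
  median-isMedian (a ∷ x) [] z =
    Between-[]ʳ (commonPrefix-prefixˡ (a ∷ x) z) ,
    Between-[]ˡ (commonPrefix-prefixʳ (a ∷ x) z) , commonPrefix-between (a ∷ x) z
  median-isMedian (a ∷ x) (b ∷ y) [] =
    commonPrefix-between (a ∷ x) (b ∷ y) ,
    Between-[]ʳ (commonPrefix-prefixʳ (a ∷ x) (b ∷ y)) ,
    Between-[]ʳ (commonPrefix-prefixˡ (a ∷ x) (b ∷ y))
  median-isMedian (a ∷ x) (b ∷ y) (c ∷ z) with a ≟ b | a ≟ c | b ≟ c
  ... | yes refl | yes refl | no a≢a = ⊥-elim (a≢a refl)
  ... | yes refl | yes refl | yes _ =
    let xy , yz , xz = median-isMedian x y z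
    in  trans (Between-∷ a xy) (dist-∷ a x y) , trans (Between-∷ a yz) (dist-∷ a y z) ,
        trans (Between-∷ a xz) (dist-∷ a x z)
  ... | yes refl | no a≢c | yes a≡c = ⊥-elim (a≢c a≡c)
  ... | yes refl | no a≢c | no _ =
    trans (Between-∷ a (commonPrefix-between x y)) (dist-∷ a x y) ,
    trans (Between-branch z a≢c (commonPrefix-prefixʳ x y)) (dist-∷-≢ y z a≢c) ,
    trans (Between-branch z a≢c (commonPrefix-prefixˡ x y)) (dist-∷-≢ x z a≢c)
  ... | no a≢b | yes refl | yes b≡a = ⊥-elim (a≢b (sym b≡a))
  ... | no a≢b | yes refl | no _ =
    trans (Between-branch y a≢b (commonPrefix-prefixˡ x z)) (dist-∷-≢ x y a≢b) ,
    trans (Between-branchˡ y a≢b (commonPrefix-prefixʳ x z)) (dist-∷-≢ y z (≢-sym a≢b)) ,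
    trans (Between-∷ a (commonPrefix-between x z)) (dist-∷ a x z)
  ... | no a≢b | no a≢c | yes refl =
    trans (Between-branchˡ x (≢-sym a≢b) (commonPrefix-prefixˡ y z)) (dist-∷-≢ x y a≢b) ,
    trans (Between-∷ b (commonPrefix-between y z)) (dist-∷ b y z) ,
    trans (Between-branchˡ x (≢-sym a≢b) (commonPrefix-prefixʳ y z)) (dist-∷-≢ x z a≢c)
  ... | no _ | no _ | no _ = refl , refl , refl

  median-prefix : ∀ x y z → Prefix (median x y z) x ⊎ Prefix (median x y z) y
  median-prefix []      y       z       = inj₂ (commonPrefix-prefixˡ y z)
  median-prefix (a ∷ x) []      z       = inj₁ (commonPrefix-prefixˡ (a ∷ x) z)
  median-prefix (a ∷ x) (b ∷ y) []      = inj₁ (commonPrefix-prefixˡ (a ∷ x) (b ∷ y))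
  median-prefix (a ∷ x) (b ∷ y) (c ∷ z) with a ≟ b | a ≟ c | b ≟ c
  ... | yes refl | yes _ | _ = Sum.map (Prefix-∷ a) (Prefix-∷ a) (median-prefix x y z)
  ... | yes _    | no  _ | _ = inj₁ (Prefix-∷ a (commonPrefix-prefixˡ x y))
  ... | no  _    | yes _ | _ = inj₁ (Prefix-∷ a (commonPrefix-prefixˡ x z))
  ... | no  _    | no  _ | yes _ = inj₂ (Prefix-∷ b (commonPrefix-prefixˡ y z))
  ... | no  _    | no  _ | no  _ = inj₁ (a ∷ x , refl)

module _ {d : ℕ} where

  open PrefixTree (Fin._≟_ {d})

  private
    variable
      x y z u v : Vertex d
      n k : ℕ

  -- Words list the letters leaf first; read from the root, 𝕋_d becomes a prefix tree.
  rootPath : Vertex d → List (Fin d)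
  rootPath v = reverse (word v)

  ρ : Vertex d → Vertex d → ℕ
  ρ x y = dist (rootPath x) (rootPath y)

  ρ-sym : ∀ x y → ρ x y ≡ ρ y x
  ρ-sym x y = dist-sym (rootPath x) (rootPath y)

  Adj-sym : Adj x y → Adj y x
  Adj-sym (inj₁ p) = inj₂ p
  Adj-sym (inj₂ p) = inj₁ p

  Adj-irrefl : Adj x y → word x ≢ word y
  Adj-irrefl (inj₁ (a , y≡)) x≡y = 1+n≢n (cong length (trans (sym y≡) (sym x≡y)))
  Adj-irrefl (inj₂ (a , x≡)) x≡y = 1+n≢n (cong length (trans (sym x≡) x≡y))

  Adj-respˡ : word x ≡ word u → Adj x y → Adj u y
  Adj-respˡ {vtx _ _} {vtx _ _} refl adj = adj

  _▷_ : Walk x y n → Adj y z → Walk x z (suc n)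
  here     ▷ adj = step adj here
  step a w ▷ adj = step a (w ▷ adj)

  reverseW : Walk x y n → Walk y x n
  reverseW here       = here
  reverseW (step {x} {y} a w) = reverseW w ▷ Adj-sym {x} {y} a

  _++W_ : Walk x y n → Walk y z k → Walk x z (n + k)
  here     ++W w′ = w′
  step a w ++W w′ = step a (w ++W w′)

  -- The reducedness proof stored in a vertex need not be unique, so distinct vertices
  -- may share a word (they are then at distance 2); a walk of positive length only
  -- depends on the words of its endpoints.
  Walk-respˡ : word x ≡ word u → Walk x y (suc n) → Walk u y (suc n)
  Walk-respˡ {x} {u} x≡u (step {y = y} a w) = step (Adj-respˡ {x} {u} {y} x≡u a) w

  Walk-respʳ : word y ≡ word v → Walk x y (suc n) → Walk x v (suc n)
  Walk-respʳ {y} {v} y≡v w = reverseW (Walk-respˡ {y} {v} y≡v (reverseW w))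

  ++W-resp : word y ≡ word u → Walk x y n → Walk u z k → 0 < n + k → Walk x z (n + k)
  ++W-resp {y} {u} y≡u w (step a w′) _ = w ++W Walk-respˡ {u} {y} (sym y≡u) (step a w′)
  ++W-resp {n = suc n} y≡u w here _ =
    subst (Walk _ _) (sym (+-identityʳ (suc n))) (Walk-respʳ y≡u w)

  rootPath-adj : Adj x y → (∃[ a ] rootPath y ≡ rootPath x ∷ʳ a) ⊎ (∃[ a ] rootPath x ≡ rootPath y ∷ʳ a)
  rootPath-adj {x} (inj₁ (a , refl)) = inj₁ (a , unfold-reverse a (word x))
  rootPath-adj {y = y} (inj₂ (a , refl)) = inj₂ (a , unfold-reverse a (word y))

  ρ-adj : ∀ x → Adj y z → ρ x y ≤ suc (ρ x z)
  ρ-adj {y} {z} x adj with rootPath-adj {y} {z} adj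
  ... | inj₁ (a , z≡) rewrite z≡ = dist-≤-∷ʳ (rootPath x) _ a
  ... | inj₂ (a , y≡) rewrite y≡ = dist-∷ʳ-≤ (rootPath x) _ a

  ρ≤length : Walk x y n → ρ x y ≤ n
  ρ≤length {x} here = ≤-reflexive (dist-refl (rootPath x))
  ρ≤length {x} {z} (step {y = y} adj w) = begin
    ρ x z       ≡⟨ ρ-sym x z ⟩
    ρ z x       ≤⟨ ρ-adj {x} {y} z adj ⟩
    suc (ρ z y) ≡⟨ cong suc (ρ-sym z y) ⟩
    suc (ρ y z) ≤⟨ s≤s (ρ≤length w) ⟩
    _           ∎
    where open ≤-Reasoning

  Reduced-tail : ∀ {a : Fin d} {w} → Reduced (a ∷ w) → Reduced w
  Reduced-tail {w = []}    _ = tt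
  Reduced-tail {w = _ ∷ _} r = proj₂ r

  climb : ∀ s w (r : Reduced (s ++ w)) → Σ (Reduced w) λ r′ → Walk (vtx (s ++ w) r) (vtx w r′) (length s)
  climb []      w r = r , here
  climb (a ∷ s) w r = let r′ , walk = climb s w (Reduced-tail r) in r′ , step (inj₂ (a , refl)) walk

  ancestor : ∀ x K s → rootPath x ≡ K ++ s → Σ (Reduced (reverse K)) λ r → Walk x (vtx (reverse K) r) (length s)
  ancestor x K s x≡K++s =
    let r , walk = climb-from x word≡ in r , subst (Walk x _) (length-reverse s) walk
    where
      word≡ : word x ≡ reverse s ++ reverse K
      word≡ = begin
        word x               ≡⟨ sym (reverse-involutive (word x)) ⟩
        reverse (rootPath x) ≡⟨ cong reverse x≡K++s ⟩
        reverse (K ++ s)     ≡⟨ reverse-++ K s ⟩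
        reverse s ++ reverse K ∎
        where open ≡-Reasoning
      climb-from : ∀ x → word x ≡ reverse s ++ reverse K →
                   Σ (Reduced (reverse K)) λ r → Walk x (vtx (reverse K) r) (length (reverse s))
      climb-from (vtx _ r) refl = climb (reverse s) (reverse K) r

  geodesic : ∀ x y → 0 < ρ x y → Walk x y (ρ x y)
  geodesic x y =
    via-ancestor (commonPrefix-prefixˡ (rootPath x) (rootPath y)) (commonPrefix-prefixʳ (rootPath x) (rootPath y))
            (commonPrefix-between (rootPath x) (rootPath y))
    where
      via-ancestor : ∀ {K} → Prefix K (rootPath x) → Prefix K (rootPath y) → Between K (rootPath x) (rootPath y) →
                0 < ρ x y → Walk x y (ρ x y)
      via-ancestor {K} (s , x≡K++s) (t , y≡K++t) between 0<ρ =
        let r , up   = ancestor x K s x≡K++s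
            r′ , down = ancestor y K t y≡K++t
            ρ≡ : length s + length t ≡ ρ x y
            ρ≡ = sym (dist-split {K} {s} {t} x≡K++s y≡K++t between)
        in subst (Walk x y) ρ≡
             (++W-resp {vtx (reverse K) r} {vtx (reverse K) r′} refl up (reverseW down) (subst (0 <_) (sym ρ≡) 0<ρ))

  Dist-refl : Dist x x 0
  Dist-refl = here , λ _ _ → z≤n

  Dist-sym : Dist x y n → Dist y x n
  Dist-sym (w , minimal) = reverseW w , λ k w′ → minimal k (reverseW w′)

  Dist-unique : Dist x y n → Dist x y k → n ≡ k
  Dist-unique (w , minimal) (w′ , minimal′) = ≤-antisym (minimal _ w′) (minimal′ _ w)

  Dist-triangle : ∀ {a b} → Dist x y n → Dist x z a → Dist y z b → n ≤ a + b
  Dist-triangle (_ , minimal) (w , _) (w′ , _) = minimal _ (w ++W reverseW w′)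

  Dist-ρ : word x ≢ word y → Dist x y (ρ x y)
  Dist-ρ {x} {y} x≢y = geodesic x y (n≢0⇒n>0 ρ≢0) , λ _ w → ρ≤length w
    where
      ρ≢0 : ρ x y ≢ 0
      ρ≢0 ρ≡0 = x≢y (reverse-injective (dist≡0⇒≡ (rootPath x) (rootPath y) ρ≡0))

  Dist-ρ-refl : Dist x x (ρ x x)
  Dist-ρ-refl {x} = subst (Dist x x) (sym (dist-refl (rootPath x))) Dist-refl

  Dist-adj : Adj x y → Dist x y 1
  Dist-adj {x} {y} adj = step adj here , minimal
    where
      minimal : ∀ k → Walk x y k → 1 ≤ k
      minimal zero    here = ⊥-elim (Adj-irrefl {x} {x} adj refl)
      minimal (suc k) _    = s≤s z≤n

  Dist-step : Dist x z (suc n) → Σ (Vertex d) λ y → Adj x y × Dist y z n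
  Dist-step (step {y = y} adj w , minimal) = y , adj , w , λ k w′ → ≤-pred (minimal (suc k) (step adj w′))

  twin-walk-length : word x ≡ word y → Walk x y (suc n) → 0 < n
  twin-walk-length {x} {y} x≡y (step adj here) = ⊥-elim (Adj-irrefl {x} {y} adj x≡y)
  twin-walk-length x≡y (step _ (step _ _)) = s≤s z≤n

  twin-Dist-≤ : word x ≡ word y → word x ≢ word z → Walk y z n → Dist x z k → k ≤ n
  twin-Dist-≤ x≡y x≢z here _ = ⊥-elim (x≢z x≡y)
  twin-Dist-≤ {x} {y} x≡y _ (step adj w) (_ , minimal) = minimal _ (Walk-respˡ {y} {x} (sym x≡y) (step adj w))

  HalfPerimeterPoint : Vertex d → Vertex d → Vertex d → ℕ → Set
  HalfPerimeterPoint x y z T = Σ (Vertex d) λ m → Σ ℕ λ p → Σ ℕ λ q → Σ ℕ λ r →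
    Dist x m p × Dist y m q × Dist z m r × 2 * (p + q + r) ≤ T

  hpp-rotate : ∀ {T} → HalfPerimeterPoint y z x T → HalfPerimeterPoint x y z T
  hpp-rotate {T = T} (m , q , r , p , dy , dz , dx , bound) =
    m , p , q , r , dx , dy , dz , subst (_≤ T) (cong (2 *_) (rotate q r p)) bound
    where rotate : ∀ q r p → q + r + p ≡ p + q + r
          rotate = solve-∀

  hpp-swap : ∀ {T} → HalfPerimeterPoint x z y T → HalfPerimeterPoint x y z T
  hpp-swap {T = T} (m , p , r , q , dx , dz , dy , bound) =
    m , p , q , r , dx , dy , dz , subst (_≤ T) (cong (2 *_) (swap p r q)) bound
    where swap : ∀ p r q → p + r + q ≡ p + q + r
          swap = solve-∀

  ρ-between : ∀ m x y → Between (rootPath m) (rootPath x) (rootPath y) → ρ x m + ρ y m ≡ ρ x y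
  ρ-between m x y between = trans (cong₂ _+_ (ρ-sym x m) (ρ-sym y m)) between

  hpp-median : ∀ {D₁ D₂ D₃} m → IsMedian (rootPath m) (rootPath x) (rootPath y) (rootPath z) →
    Dist x m (ρ x m) → Dist y m (ρ y m) → Dist z m (ρ z m) →
    Walk x y D₁ → Walk y z D₂ → Walk x z D₃ → HalfPerimeterPoint x y z (D₁ + D₂ + D₃)
  hpp-median {x} {y} {z} {D₁} {D₂} {D₃} m (xy , yz , xz) dx dy dz wxy wyz wxz =
    m , ρ x m , ρ y m , ρ z m , dx , dy , dz , (begin
      2 * (ρ x m + ρ y m + ρ z m)                             ≡⟨ pairwise (ρ x m) (ρ y m) (ρ z m) ⟩
      (ρ x m + ρ y m) + (ρ y m + ρ z m) + (ρ x m + ρ z m)     ≡⟨ cong₂ _+_ (cong₂ _+_ (ρ-between m x y xy) (ρ-between m y z yz)) (ρ-between m x z xz) ⟩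
      ρ x y + ρ y z + ρ x z                                   ≤⟨ +-mono-≤ (+-mono-≤ (ρ≤length wxy) (ρ≤length wyz)) (ρ≤length wxz) ⟩
      D₁ + D₂ + D₃                                            ∎)
    where
      open ≤-Reasoning
      pairwise : ∀ p q r → 2 * (p + q + r) ≡ (p + q) + (q + r) + (p + r)
      pairwise = solve-∀

  prefix-vertex : ∀ v {K} → Prefix K (rootPath v) → Σ (Vertex d) λ m → rootPath m ≡ K
  prefix-vertex v {K} (s , v≡K++s) = let r , _ = ancestor v K s v≡K++s in vtx (reverse K) r , reverse-involutive K

  hpp-distinct : ∀ {D₁ D₂ D₃} → word x ≢ word y → word y ≢ word z → word x ≢ word z →
    Walk x y D₁ → Walk y z D₂ → Walk x z D₃ → HalfPerimeterPoint x y z (D₁ + D₂ + D₃)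
  hpp-distinct {x} {y} {z} x≢y y≢z x≢z wxy wyz wxz = pick (M ≟ₗ rootPath x) (M ≟ₗ rootPath y) (M ≟ₗ rootPath z)
    where
      _≟ₗ_ = ≡-dec Fin._≟_
      M = median (rootPath x) (rootPath y) (rootPath z)
      at : ∀ m → rootPath m ≡ M → Dist x m (ρ x m) → Dist y m (ρ y m) → Dist z m (ρ z m) →
           HalfPerimeterPoint x y z _
      at m m≡M dx dy dz = hpp-median m (subst (λ K → IsMedian K (rootPath x) (rootPath y) (rootPath z)) (sym m≡M)
                                            (median-isMedian (rootPath x) (rootPath y) (rootPath z)))
                                     dx dy dz wxy wyz wxz
      pick : Dec (M ≡ rootPath x) → Dec (M ≡ rootPath y) → Dec (M ≡ rootPath z) → HalfPerimeterPoint x y z _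
      pick (yes M≡x) _ _ = at x (sym M≡x) Dist-ρ-refl (Dist-ρ (≢-sym x≢y)) (Dist-ρ (≢-sym x≢z))
      pick (no _) (yes M≡y) _ = at y (sym M≡y) (Dist-ρ x≢y) Dist-ρ-refl (Dist-ρ (≢-sym y≢z))
      pick (no _) (no _) (yes M≡z) = at z (sym M≡z) (Dist-ρ x≢z) (Dist-ρ y≢z) Dist-ρ-refl
      pick (no M≢x) (no M≢y) (no M≢z) =
        let m , m≡M = [ prefix-vertex x , prefix-vertex y ]′ (median-prefix (rootPath x) (rootPath y) (rootPath z))
            apart : ∀ v → M ≢ rootPath v → word v ≢ word m
            apart _ M≢v v≡m = M≢v (trans (sym m≡M) (cong reverse (sym v≡m)))
        in at m m≡M (Dist-ρ (apart x M≢x)) (Dist-ρ (apart y M≢y)) (Dist-ρ (apart z M≢z))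

  neighbour : Fin d → ∀ x → Σ (Vertex d) (Adj x)
  neighbour l (vtx []      _) = vtx (l ∷ []) tt , inj₁ (l , refl)
  neighbour _ (vtx (b ∷ w) r) = vtx w (Reduced-tail r) , inj₂ (b , refl)

  hpp-refl : ∀ {D₂ D₃} → Dist x z D₂ → Dist x z D₃ → HalfPerimeterPoint x x z (0 + D₂ + D₃)
  hpp-refl {x} {z} {D₂} {D₃} dxz dxz′ =
    x , 0 , 0 , D₃ , Dist-refl , Dist-refl , Dist-sym dxz′ ,
    ≤-reflexive (trans (double D₃) (cong (_+ D₃) (Dist-unique dxz′ dxz)))
    where double : ∀ t → 2 * (0 + 0 + t) ≡ t + t
          double = solve-∀

  hpp-twins : ∀ {D₁ D₂ D₃} → word x ≡ word y → word x ≢ word z →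
    Walk x y (suc D₁) → Dist y z D₂ → Dist x z D₃ → HalfPerimeterPoint x y z (suc D₁ + D₂ + D₃)
  hpp-twins x≡y x≢z _ _ (here , _) = ⊥-elim (x≢z refl)
  hpp-twins {x} {y} {z} {D₁} {D₂} {suc t} x≡y x≢z wxy (wyz , _) dxz =
    let n , adj , dnz = Dist-step dxz in
    n , 1 , 1 , t , Dist-adj adj , Dist-adj (Adj-respˡ {x} {y} {n} x≡y adj) , Dist-sym dnz ,
    (begin
      2 * (1 + 1 + t)     ≡⟨ regroup t ⟩
      2 + suc t + suc t   ≤⟨ +-monoˡ-≤ (suc t) (+-mono-≤ (s≤s (twin-walk-length x≡y wxy)) (twin-Dist-≤ x≡y x≢z wyz dxz)) ⟩
      suc D₁ + D₂ + suc t ∎)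
    where
      open ≤-Reasoning
      regroup : ∀ t → 2 * (1 + 1 + t) ≡ 2 + suc t + suc t
      regroup = solve-∀

  -- For pairwise distinct vertices sharing one word a common neighbour serves; this is
  -- the only place where a letter of the alphabet is needed.
  hpp-triplets : Fin d → ∀ {D₁ D₂ D₃} → word x ≡ word y → word x ≡ word z →
    Dist x y (suc D₁) → Dist y z D₂ → Dist x z D₃ → HalfPerimeterPoint x y z (suc D₁ + D₂ + D₃)
  hpp-triplets {x} {y} _ {D₁} _ _ dxy (here , _) dxz =
    y , suc D₁ , 0 , 0 , dxy , Dist-refl , Dist-refl ,
    ≤-reflexive (trans (double (suc D₁)) (cong (suc D₁ + 0 +_) (Dist-unique dxy dxz)))
    where double : ∀ t → 2 * (t + 0 + 0) ≡ t + 0 + t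
          double = solve-∀
  hpp-triplets {x} {y} _ {D₁} {D₂} _ _ dxy dyx (here , _) =
    x , 0 , suc D₁ , 0 , Dist-refl , Dist-sym dxy , Dist-refl ,
    ≤-reflexive (trans (double (suc D₁)) (cong (λ t → suc D₁ + t + 0) (Dist-unique (Dist-sym dxy) dyx)))
    where double : ∀ t → 2 * (0 + t + 0) ≡ t + t + 0
          double = solve-∀
  hpp-triplets {x} {y} {z} l {D₁} {suc D₂} {suc D₃} x≡y x≡z (wxy , _) (wyz , _) (wxz , _) =
    let n , adj = neighbour l x in
    n , 1 , 1 , 1 , Dist-adj adj , Dist-adj (Adj-respˡ {x} {y} {n} x≡y adj) , Dist-adj (Adj-respˡ {x} {z} {n} x≡z adj) ,
    +-mono-≤ (+-mono-≤ (s≤s (twin-walk-length x≡y wxy)) (s≤s (twin-walk-length (trans (sym x≡y) x≡z) wyz)))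
             (s≤s (twin-walk-length x≡z wxz))

  hpp-coincident : Fin d → ∀ {D₁ D₂ D₃} → word x ≡ word y →
    Dist x y D₁ → Dist y z D₂ → Dist x z D₃ → HalfPerimeterPoint x y z (D₁ + D₂ + D₃)
  hpp-coincident _ _ (here , _) dyz dxz = hpp-refl dyz dxz
  hpp-coincident {x} {y} {z} l x≡y dxy@(step _ _ , _) dyz dxz with ≡-dec Fin._≟_ (word x) (word z)
  ... | yes x≡z = hpp-triplets l x≡y x≡z dxy dyz dxz
  ... | no  x≢z = hpp-twins x≡y x≢z (proj₁ dxy) dyz dxz

  halfPerimeterPoint : Fin d → ∀ {D₁ D₂ D₃} →
    Dist x y D₁ → Dist y z D₂ → Dist x z D₃ → HalfPerimeterPoint x y z (D₁ + D₂ + D₃)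
  halfPerimeterPoint {x} {y} {z} l {D₁} {D₂} {D₃} dxy dyz dxz
    with ≡-dec Fin._≟_ (word x) (word y) | ≡-dec Fin._≟_ (word y) (word z) | ≡-dec Fin._≟_ (word x) (word z)
  ... | yes x≡y | _ | _ = hpp-coincident l x≡y dxy dyz dxz
  ... | no _ | yes y≡z | _ =
    hpp-rotate (subst (HalfPerimeterPoint y z x) (rotate D₁ D₂ D₃)
                      (hpp-coincident l y≡z dyz (Dist-sym dxz) (Dist-sym dxy)))
    where rotate : ∀ a b c → b + c + a ≡ a + b + c
          rotate = solve-∀
  ... | no _ | no _ | yes x≡z =
    hpp-swap (subst (HalfPerimeterPoint x z y) (reverse-sum D₁ D₂ D₃)
                    (hpp-coincident l x≡z dxz (Dist-sym dyz) dxy))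
    where reverse-sum : ∀ a b c → c + b + a ≡ a + b + c
          reverse-sum = solve-∀
  ... | no x≢y | no y≢z | no x≢z = hpp-distinct x≢y y≢z x≢z (proj₁ dxy) (proj₁ dyz) (proj₁ dxz)

  record CenterDistances (x y z c : Vertex d) (D₁ D₂ D₃ : ℕ) : Set where
    field
      a b e    : ℕ
      x-c      : Dist x c a
      y-c      : Dist y c b
      z-c      : Dist z c e
      split-xy : D₁ ≡ a + b
      split-yz : D₂ ≡ b + e
      split-xz : D₃ ≡ a + e

  center-between : Fin d → ∀ {c D₁ D₂ D₃} → Dist x y D₁ → Dist y z D₂ → Dist x z D₃ →
    IsCenter x y z c → CenterDistances x y z c D₁ D₂ D₃
  center-between l {D₁ = D₁} {D₂} {D₃} dxy dyz dxz (a , b , e , x-c , y-c , z-c , minimal) =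
    let m , p , q , r , x-m , y-m , z-m , p+q+r≤ = halfPerimeterPoint l dxy dyz dxz
        split-xy , split-yz , split-xz =
          +-squeeze (Dist-triangle dxy x-c y-c) (Dist-triangle dyz y-c z-c) (Dist-triangle dxz x-c z-c) (begin
            (a + b) + (b + e) + (a + e) ≡⟨ pairwise a b e ⟩
            2 * (a + b + e)             ≤⟨ *-monoʳ-≤ 2 (minimal m p q r x-m y-m z-m) ⟩
            2 * (p + q + r)             ≤⟨ p+q+r≤ ⟩
            D₁ + D₂ + D₃                ∎)
    in record { x-c = x-c ; y-c = y-c ; z-c = z-c ; split-xy = split-xy ; split-yz = split-yz ; split-xz = split-xz }
    where
      open ≤-Reasoning
      pairwise : ∀ a b e → (a + b) + (b + e) + (a + e) ≡ 2 * (a + b + e)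
      pairwise = solve-∀

sumV-toList : ∀ {m} (v : Vec ℕ m) → sumV v ≡ sum (toList v)
sumV-toList []      = refl
sumV-toList (n ∷ v) = cong (n +_) (sumV-toList v)

sumV-↭ : ∀ {m} {u v : Vec ℕ m} → toList u ↭ toList v → sumV u ≡ sumV v
sumV-↭ {u = u} {v} u↭v = trans (sumV-toList u) (trans (sum-↭ u↭v) (sym (sumV-toList v)))

sumV-tabulate-+ : ∀ {m} (u : Vec ℕ m) (f g : Fin m → ℕ) →
  (∀ i → lookup u i ≡ f i + g i) → sumV u ≡ sumV (tabulate f) + sumV (tabulate g)
sumV-tabulate-+ []      f g u≡ = refl
sumV-tabulate-+ (n ∷ u) f g u≡ =
  trans (cong₂ _+_ (u≡ Fin.zero) (sumV-tabulate-+ u (f ∘ Fin.suc) (g ∘ Fin.suc) (u≡ ∘ Fin.suc)))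
        (regroup (f Fin.zero) (g Fin.zero) (sumV (tabulate (f ∘ Fin.suc))) (sumV (tabulate (g ∘ Fin.suc))))
  where regroup : ∀ a b p q → (a + b) + (p + q) ≡ (a + p) + (b + q)
        regroup = solve-∀

δ≡-tabulate : ∀ {d m} (xs ys : Tuple d m) (f : Fin m → ℕ) →
  (∀ i → Dist (lookup xs i) (lookup ys i) (f i)) → δ≡ xs ys (sumV (tabulate f))
δ≡-tabulate xs ys f dist = tabulate f , (λ i → subst (Dist (lookup xs i) (lookup ys i)) (sym (lookup∘tabulate f i)) (dist i)) , refl

record CenterDeltas {d m} (xs ys zs cs : Tuple d m) (D₁ D₂ D₃ : ℕ) : Set where
  field
    α β γ    : ℕ
    xs-cs    : δ≡ xs cs α
    ys-cs    : δ≡ ys cs β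
    zs-cs    : δ≡ zs cs γ
    split-xy : D₁ ≡ α + β
    split-yz : D₂ ≡ β + γ
    split-xz : D₃ ≡ α + γ

δ-center-between : ∀ {d m} (xs ys zs cs : Tuple d m) (ds₁ ds₂ ds₃ : Vec ℕ m) → Fin d →
  DistVec xs ys ds₁ → DistVec ys zs ds₂ → DistVec xs zs ds₃ →
  (∀ i → IsCenter (lookup xs i) (lookup ys i) (lookup zs i) (lookup cs i)) →
  CenterDeltas xs ys zs cs (sumV ds₁) (sumV ds₂) (sumV ds₃)
δ-center-between xs ys zs cs ds₁ ds₂ ds₃ l xy yz xz center = record
  { xs-cs    = δ≡-tabulate xs cs (a ∘ split) (x-c ∘ split)
  ; ys-cs    = δ≡-tabulate ys cs (b ∘ split) (y-c ∘ split)
  ; zs-cs    = δ≡-tabulate zs cs (e ∘ split) (z-c ∘ split)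
  ; split-xy = sumV-tabulate-+ ds₁ (a ∘ split) (b ∘ split) (split-xy ∘ split)
  ; split-yz = sumV-tabulate-+ ds₂ (b ∘ split) (e ∘ split) (split-yz ∘ split)
  ; split-xz = sumV-tabulate-+ ds₃ (a ∘ split) (e ∘ split) (split-xz ∘ split)
  }
  where
    open CenterDistances
    split : ∀ i → CenterDistances (lookup xs i) (lookup ys i) (lookup zs i) (lookup cs i)
                                  (lookup ds₁ i) (lookup ds₂ i) (lookup ds₃ i)
    split i = center-between l (xy i) (yz i) (xz i) (center i)

equal-pair-sums : ∀ {a b c s} → a + b ≡ s → b + c ≡ s → a + c ≡ s → a ≡ b × b ≡ c
equal-pair-sums {a} {b} {c} a+b≡ b+c≡ a+c≡ =
  +-cancelʳ-≡ c a b (trans a+c≡ (sym b+c≡)) , +-cancelˡ-≡ a b c (trans a+b≡ (sym a+c≡))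

midpoint : ∀ {d m a b} (us vs ws : Tuple d m) → δ≡ us ws a → δ≡ vs ws b → δ≡ us vs (a + b) → a ≡ b → Midpoint us vs ws
midpoint {a = a} {b} _ _ _ uw vw uv a≡b = a , b , a + b , uw , vw , uv , a≡b , cong (a +_) a≡b

claim3p5 : (d m : ℕ) → 3 ≤ d → (S : Vec ℕ m) → (xs ys zs cs : Tuple d m) →
    PolyAdj S xs ys → PolyAdj S ys zs → PolyAdj S xs zs →
    (∀ i → IsCenter (lookup xs i) (lookup ys i) (lookup zs i) (lookup cs i)) →
    Midpoint xs ys cs × Midpoint ys zs cs × Midpoint xs zs cs
claim3p5 (suc d) m (s≤s _) S xs ys zs cs (ds₁ , xy , xy↭S) (ds₂ , yz , yz↭S) (ds₃ , xz , xz↭S) center =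
  midpoint xs ys cs xs-cs ys-cs (ds₁ , xy , split-xy) α≡β ,
  midpoint ys zs cs ys-cs zs-cs (ds₂ , yz , split-yz) β≡γ ,
  midpoint xs zs cs xs-cs zs-cs (ds₃ , xz , split-xz) (trans α≡β β≡γ)
  where
    open CenterDeltas (δ-center-between xs ys zs cs ds₁ ds₂ ds₃ Fin.zero xy yz xz center)
    equalities : α ≡ β × β ≡ γ
    equalities = equal-pair-sums (trans (sym split-xy) (sumV-↭ xy↭S)) (trans (sym split-yz) (sumV-↭ yz↭S))
                                 (trans (sym split-xz) (sumV-↭ xz↭S))
    α≡β = proj₁ equalities
    β≡γ = proj₂ equalities
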